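{- Let $L$ be a complete lattice and $\mathfrak{X}=(X,\le,(R_i)_{i\in I},(S_j)_{j\in J})$ an ordered extended relational structure of type $\tau=(\tau_1,\tau_2)$. Then the set of order-preserving functions $X\to L$ is a subalgebra of the extended convolution algebra $L^{\mathfrak{X}*}$ (closed under pointwise $\wedge,\vee$, the constants $0,1$, and all $f_i$ and $g_j$).
   Context: $\le$ is a partial order on $X$, $R_i\subseteq X^{n_i+1}$, $S_j\subseteq X^{n_j+1}$, such that if $(x_1,\ldots,x_{n_i},x)\in R_i$ and $x\le y$ then $(x_1,\ldots,x_{n_i},y)\in R_i$, and if $(x_1,\ldots,x_{n_j},x)\in S_j$ and $y\le x$ then $(x_1,\ldots,x_{n_j},y)\in S_j$. $L^{\mathfrak{X}*}$ is $L^X$ with pointwise $\wedge,\vee,0,1$ and $f_i(\alpha_1,\ldots,\alpha_{n_i})(x)=\bigvee\{\alpha_1(x_1)\wedge\cdots\wedge\alpha_{n_i}(x_{n_i}):(x_1,\ldots,x_{n_i},x)\in R_i\}$, $g_j(\alpha_1,\ldots,\alpha_{n_j})(x)=\bigwedge\{\alpha_1(x_1)\vee\cdots\vee\alpha_{n_j}(x_{n_j}):(x_1,\ldots,x_{n_j},x)\in S_j\}$. -}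

module Defs where

open import Level using (Level; _⊔_) renaming (suc to lsuc)
open import Data.Nat using (ℕ; zero; suc)
open import Data.Fin using (Fin; zero; suc)
open import Data.Product using (Σ; _×_; _,_)
open import Relation.Binary.Core using (Rel)
open import Relation.Binary.PropositionalEquality using (_≡_)
open import Relation.Binary.Structures using (IsPartialOrder)
open import Relation.Binary.Lattice.Structures using (IsBoundedLattice)

record CompleteLattice (c ℓ₁ ℓ₂ ι : Level) : Set (lsuc (c ⊔ ℓ₁ ⊔ ℓ₂ ⊔ ι)) where
  infixr 6 _∨_
  infixr 7 _∧_
  field
    Carrier : Set c
    _≈_     : Rel Carrier ℓ₁
    _≤_     : Rel Carrier ℓ₂
    _∨_     : Carrier → Carrier → Carrier
    _∧_     : Carrier → Carrier → Carrier
    ⊤       : Carrier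
    ⊥       : Carrier
    isBoundedLattice : IsBoundedLattice _≈_ _≤_ _∨_ _∧_ ⊤ ⊥
    ⋁       : {A : Set ι} → (A → Carrier) → Carrier
    ⋀       : {A : Set ι} → (A → Carrier) → Carrier
    ⋁-upper : {A : Set ι} (f : A → Carrier) (a : A) → f a ≤ ⋁ f
    ⋁-least : {A : Set ι} (f : A → Carrier) (z : Carrier) →
              (∀ a → f a ≤ z) → ⋁ f ≤ z
    ⋀-lower : {A : Set ι} (f : A → Carrier) (a : A) → ⋀ f ≤ f a
    ⋀-great : {A : Set ι} (f : A → Carrier) (z : Carrier) →
              (∀ a → z ≤ f a) → z ≤ ⋀ f

  open IsBoundedLattice isBoundedLattice public

  meetⁿ : (n : ℕ) → (Fin n → Carrier) → Carrier
  meetⁿ zero    a = ⊤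
  meetⁿ (suc n) a = a zero ∧ meetⁿ n (λ k → a (suc k))

  joinⁿ : (n : ℕ) → (Fin n → Carrier) → Carrier
  joinⁿ zero    a = ⊥
  joinⁿ (suc n) a = a zero ∨ joinⁿ n (λ k → a (suc k))

-- Ordered extended relational structures of type τ = (τ₁ , τ₂),
-- τ₁ : I → ℕ, τ₂ : J → ℕ.  R i ⊆ X^{τ₁ i + 1} is encoded as a predicate
-- R i xs x meaning (xs 0, …, xs (n-1), x) ∈ R i.

record OERS {i j : Level} {I : Set i} {J : Set j}
            (τ₁ : I → ℕ) (τ₂ : J → ℕ) (x ℓ r : Level)
            : Set (i ⊔ j ⊔ lsuc (x ⊔ ℓ ⊔ r)) where
  field
    X    : Set x
    _≤_  : Rel X ℓ
    isPartialOrder : IsPartialOrder _≡_ _≤_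
    R    : (a : I) → (Fin (τ₁ a) → X) → X → Set r
    S    : (b : J) → (Fin (τ₂ b) → X) → X → Set r
    R-up   : ∀ a (xs : Fin (τ₁ a) → X) {y z} → R a xs y → y ≤ z → R a xs z
    S-down : ∀ b (xs : Fin (τ₂ b) → X) {y z} → S b xs y → z ≤ y → S b xs z

module Convolution {c ℓ₁ ℓ₂ i j x ℓ r : Level}
  {I : Set i} {J : Set j} {τ₁ : I → ℕ} {τ₂ : J → ℕ}
  (L : CompleteLattice c ℓ₁ ℓ₂ (x ⊔ r))
  (𝔛 : OERS τ₁ τ₂ x ℓ r) where

  open CompleteLattice L
    renaming (_≤_ to _≤L_; Carrier to C)
  open OERS 𝔛

  _∧ᶜ_ : (X → C) → (X → C) → (X → C)
  (α ∧ᶜ β) p = α p ∧ β p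

  _∨ᶜ_ : (X → C) → (X → C) → (X → C)
  (α ∨ᶜ β) p = α p ∨ β p

  0ᶜ : X → C
  0ᶜ p = ⊥

  1ᶜ : X → C
  1ᶜ p = ⊤

  f : (a : I) → (Fin (τ₁ a) → (X → C)) → (X → C)
  f a α p = ⋁ {A = Σ (Fin (τ₁ a) → X) (λ xs → R a xs p)}
              (λ { (xs , _) → meetⁿ (τ₁ a) (λ k → α k (xs k)) })

  g : (b : J) → (Fin (τ₂ b) → (X → C)) → (X → C)
  g b α p = ⋀ {A = Σ (Fin (τ₂ b) → X) (λ xs → S b xs p)}
              (λ { (xs , _) → joinⁿ (τ₂ b) (λ k → α k (xs k)) })

  OrderPreserving : (X → C) → Set (x ⊔ ℓ ⊔ ℓ₂)
  OrderPreserving α = ∀ {p q} → p ≤ q → α p ≤L α q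

  IsSubalgebraOP : Set (i ⊔ j ⊔ x ⊔ ℓ ⊔ ℓ₂ ⊔ c)
  IsSubalgebraOP =
      (∀ α β → OrderPreserving α → OrderPreserving β → OrderPreserving (α ∧ᶜ β))
    × (∀ α β → OrderPreserving α → OrderPreserving β → OrderPreserving (α ∨ᶜ β))
    × OrderPreserving 0ᶜ
    × OrderPreserving 1ᶜ
    × (∀ a (α : Fin (τ₁ a) → X → C) →
         (∀ k → OrderPreserving (α k)) → OrderPreserving (f a α))
    × (∀ b (α : Fin (τ₂ b) → X → C) →
         (∀ k → OrderPreserving (α k)) → OrderPreserving (g b α))

-- The operations f_i only look at tuples (x₁,…,xₙ,x) ∈ R_i, and R_i is closed upwards in its
-- last coordinate: raising x to y enlarges the index family of the join defining f_i(α)(x),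
-- so f_i(α) is order-preserving for every α, not only for order-preserving ones. Dually the
-- S_j are closed downwards, so lowering x enlarges the family of the meet defining g_j(α)(x).
module Submission where

open import Defs
open import Level using (Level; _⊔_)
open import Data.Nat using (ℕ)
open import Data.Product using (_,_)
open import Relation.Binary.Lattice.Bundles using (JoinSemilattice; MeetSemilattice)
import Relation.Binary.Lattice.Properties.JoinSemilattice as JoinSemilatticeProperties
import Relation.Binary.Lattice.Properties.MeetSemilattice as MeetSemilatticeProperties

module CompleteLatticeProperties {c ℓ₁ ℓ₂ ι : Level} (L : CompleteLattice c ℓ₁ ℓ₂ ι) where
  open CompleteLattice L

  joinSemilattice : JoinSemilattice c ℓ₁ ℓ₂
  joinSemilattice = record { isJoinSemilattice = isJoinSemilattice }

  meetSemilattice : MeetSemilattice c ℓ₁ ℓ₂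
  meetSemilattice = record { isMeetSemilattice = isMeetSemilattice }

  open JoinSemilatticeProperties joinSemilattice public using (∨-monotonic)
  open MeetSemilatticeProperties meetSemilattice public using (∧-monotonic)

  ⋁-reindex-≤ : {A B : Set ι} {u : A → Carrier} {v : B → Carrier} (h : A → B) →
                (∀ a → u a ≤ v (h a)) → ⋁ u ≤ ⋁ v
  ⋁-reindex-≤ {v = v} h u≤vh = ⋁-least _ _ (λ a → trans (u≤vh a) (⋁-upper v (h a)))

  ⋀-reindex-≤ : {A B : Set ι} {u : A → Carrier} {v : B → Carrier} (h : B → A) →
                (∀ b → u (h b) ≤ v b) → ⋀ u ≤ ⋀ v
  ⋀-reindex-≤ {u = u} h uh≤v = ⋀-great _ _ (λ b → trans (⋀-lower u (h b)) (uh≤v b))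

module _ {c ℓ₁ ℓ₂ i j x ℓ r : Level} {I : Set i} {J : Set j}
         {τ₁ : I → ℕ} {τ₂ : J → ℕ}
         (L : CompleteLattice c ℓ₁ ℓ₂ (x ⊔ r)) (𝔛 : OERS τ₁ τ₂ x ℓ r) where
  open Convolution L 𝔛
  open CompleteLattice L using (refl)
  open CompleteLatticeProperties L
  open OERS 𝔛 using (R-up; S-down)

  ∧ᶜ-orderPreserving : ∀ α β → OrderPreserving α → OrderPreserving β →
                       OrderPreserving (α ∧ᶜ β)
  ∧ᶜ-orderPreserving _ _ α↑ β↑ p≤q = ∧-monotonic (α↑ p≤q) (β↑ p≤q)

  ∨ᶜ-orderPreserving : ∀ α β → OrderPreserving α → OrderPreserving β →
                       OrderPreserving (α ∨ᶜ β)
  ∨ᶜ-orderPreserving _ _ α↑ β↑ p≤q = ∨-monotonic (α↑ p≤q) (β↑ p≤q)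

  0ᶜ-orderPreserving : OrderPreserving 0ᶜ
  0ᶜ-orderPreserving _ = refl

  1ᶜ-orderPreserving : OrderPreserving 1ᶜ
  1ᶜ-orderPreserving _ = refl

  f-orderPreserving : ∀ a α → OrderPreserving (f a α)
  f-orderPreserving a _ p≤q = ⋁-reindex-≤ (λ { (xs , xs⟨R⟩p) → xs , R-up a xs xs⟨R⟩p p≤q })
                                          (λ _ → refl)

  g-orderPreserving : ∀ b α → OrderPreserving (g b α)
  g-orderPreserving b _ p≤q = ⋀-reindex-≤ (λ { (xs , xs⟨S⟩q) → xs , S-down b xs xs⟨S⟩q p≤q })
                                          (λ _ → refl)

proposition5p18 : {c ℓ₁ ℓ₂ i j x ℓ r : Level} {I : Set i} {J : Set j}
    {τ₁ : I → ℕ} {τ₂ : J → ℕ}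
    (L : CompleteLattice c ℓ₁ ℓ₂ (x ⊔ r)) (𝔛 : OERS τ₁ τ₂ x ℓ r) →
    Convolution.IsSubalgebraOP L 𝔛
proposition5p18 L 𝔛 =
    ∧ᶜ-orderPreserving L 𝔛
  , ∨ᶜ-orderPreserving L 𝔛
  , 0ᶜ-orderPreserving L 𝔛
  , 1ᶜ-orderPreserving L 𝔛
  , (λ a α _ → f-orderPreserving L 𝔛 a α)
  , (λ b α _ → g-orderPreserving L 𝔛 b α)
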